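{- Let $E$ be an effect algebra containing an atom $p$ with $2\le\operatorname{ord}(p)<\infty$. Then $E$ admits no total binary operation satisfying (S1)–(S4).
   Context: An effect algebra is $(E,0,1,\oplus)$ with $\oplus$ a partial binary operation that is commutative, associative (in the partial sense), has for each $a$ a unique orthosupplement $a'$ with $a\oplus a'=1$, and satisfies: $a\oplus 1$ defined implies $a=0$. Write $a\perp b$ when $a\oplus b$ is defined; $a\le b$ iff $b=a\oplus c$ for some $c$. An atom is a minimal nonzero element. For $n\in\mathbb{N}$, $na=a\oplus\cdots\oplus a$ ($n$ times) when defined, and $\operatorname{ord}(a)=\sup\{n: na \text{ exists}\}\in\mathbb{N}\cup\{\infty\}$ is the isotropic index. For a total binary operation $\circ$ on $E$, write $a\mid b$ for $a\circ b=b\circ a$. Axioms: (S1) $b\perp c\Rightarrow a\circ(b\oplus c)=(a\circ b)\oplus(a\circ c)$; (S2) $1\circ a=a$; (S3) $a\circ b=0\Rightarrow a\circ b=b\circ a$; (S4) if $a\mid b$ then $a\mid b'$ and $a\circ(b\circ c)=(a\circ b)\circ c$ for all $c$. -}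

module Defs where

open import Data.Nat using (ℕ; zero; suc; _≤_)
open import Data.Maybe using (Maybe; just; nothing; _>>=_; Is-just)
open import Data.Product using (Σ; ∃; _×_; _,_)
open import Data.Sum using (_⊎_)
open import Relation.Nullary using (¬_)
open import Relation.Binary.PropositionalEquality using (_≡_; _≢_)

-- An effect algebra (Foulis–Bennett).  The partial operation ⊕ is a total
-- function into Maybe E: a ⊕ b ≡ nothing means "a ⊕ b is undefined".
record EffectAlgebra : Set₁ where
  infixl 6 _⊕_
  field
    E    : Set
    𝟘 𝟙  : E
    _⊕_  : E → E → Maybe E
    _′   : E → E
    ⊕-comm  : ∀ a b → a ⊕ b ≡ b ⊕ a
    ⊕-assoc : ∀ a b c d e → a ⊕ b ≡ just d → d ⊕ c ≡ just e →
              Σ E λ f → (b ⊕ c ≡ just f) × (a ⊕ f ≡ just e)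
    ′-supp  : ∀ a → a ⊕ (a ′) ≡ just 𝟙
    ′-uniq  : ∀ a b → a ⊕ b ≡ just 𝟙 → b ≡ a ′
    zero-one : ∀ a x → a ⊕ 𝟙 ≡ just x → a ≡ 𝟘
    -- 0 is the neutral element (derivable from the above with 0 := 1′;
    -- stated here to tie the constant 𝟘 to the structure)
    ⊕-identity : ∀ a → a ⊕ 𝟘 ≡ just a

module _ (EA : EffectAlgebra) where
  open EffectAlgebra EA

  _⊥_ : E → E → Set
  a ⊥ b = Is-just (a ⊕ b)

  _≼_ : E → E → Set
  a ≼ b = Σ E λ c → a ⊕ c ≡ just b

  IsAtom : E → Set
  IsAtom p = (p ≢ 𝟘) × (∀ q → q ≼ p → q ≢ 𝟘 → q ≡ p)

  mult : ℕ → E → Maybe E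
  mult zero    a = just 𝟘
  mult (suc n) a = mult n a >>= λ x → x ⊕ a

  MultDefined : ℕ → E → Set
  MultDefined n a = Is-just (mult n a)

  TwoLeOrd : E → Set
  TwoLeOrd a = MultDefined 2 a

  OrdFinite : E → Set
  OrdFinite a = Σ ℕ λ N → ∀ n → MultDefined n a → n ≤ N

  Commute : (E → E → E) → E → E → Set
  Commute _∘_ a b = a ∘ b ≡ b ∘ a

  record IsSequentialProduct (_∘_ : E → E → E) : Set where
    field
      S1 : ∀ a b c d → b ⊕ c ≡ just d → (a ∘ b) ⊕ (a ∘ c) ≡ just (a ∘ d)
      S2 : ∀ a → 𝟙 ∘ a ≡ a
      S3 : ∀ a b → a ∘ b ≡ 𝟘 → a ∘ b ≡ b ∘ a
      S4 : ∀ a b → Commute _∘_ a b →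
           Commute _∘_ a (b ′) × (∀ c → a ∘ (b ∘ c) ≡ (a ∘ b) ∘ c)

{-# OPTIONS --safe #-}
-- Since p ∘ p ⊕ p ∘ p′ = p, atomicity leaves only p ∘ p = p or p ∘ p = 0.
-- If p ∘ p = p, then p ∘ (p ⊕ p) = p ⊕ p, yet p ∘ (p ⊕ p) ≤ p, which forces p = 0.
-- If p ∘ p = 0, then p ∘ (n·p) = 0 for every defined multiple n·p.  Now a ∘ b = 0
-- makes a and b commute, so by (S4) a commutes with b′ and b′ ∘ a = a ∘ b′ = a;
-- hence a ≤ b′, i.e. a ⊥ b.  For the largest defined multiple n·p this says that
-- (n+1)·p is defined, contradicting ord(p) < ∞.
module Submission where

open import Defs
open import Data.Nat using (ℕ; zero; suc)
open import Data.Nat.Properties using (1+n≰n)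
open import Data.Maybe using (just; nothing; Is-just)
open import Data.Maybe.Properties using (just-injective)
open import Data.Maybe.Relation.Unary.Any using (just)
open import Data.Product using (Σ; _×_; _,_; proj₁)
open import Data.Unit using (tt)
open import Relation.Nullary using (¬_; contradiction)
open import Relation.Binary.PropositionalEquality
open EffectAlgebra using (E)

module EffectAlgebraProperties (EA : EffectAlgebra) where
  open EffectAlgebra EA hiding (E)

  ⊕-identityˡ : ∀ a → 𝟘 ⊕ a ≡ just a
  ⊕-identityˡ a = trans (⊕-comm 𝟘 a) (⊕-identity a)

  𝟙≡𝟘′ : 𝟙 ≡ 𝟘 ′
  𝟙≡𝟘′ = ′-uniq 𝟘 𝟙 (⊕-identityˡ 𝟙)

  -- y ⊕ (w′ ⊕ x) = (x ⊕ y) ⊕ w′ = 1.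
  ⊕-complement : ∀ x y w → x ⊕ y ≡ just w →
                 Σ (E EA) λ h → (w ′ ⊕ x ≡ just h) × (y ≡ h ′)
  ⊕-complement x y w x⊕y≡w
    with ⊕-assoc x y (w ′) w 𝟙 x⊕y≡w (′-supp w)
  ... | g , y⊕w′≡g , x⊕g≡𝟙
    with ⊕-assoc y (w ′) x g 𝟙 y⊕w′≡g (trans (⊕-comm g x) x⊕g≡𝟙)
  ... | h , w′⊕x≡h , y⊕h≡𝟙 = h , w′⊕x≡h , ′-uniq h y (trans (⊕-comm h y) y⊕h≡𝟙)

  ⊕-cancelˡ : ∀ x y z w → x ⊕ y ≡ just w → x ⊕ z ≡ just w → y ≡ z
  ⊕-cancelˡ x y z w x⊕y≡w x⊕z≡w
    with ⊕-complement x y w x⊕y≡w | ⊕-complement x z w x⊕z≡w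
  ... | h , w′⊕x≡h , y≡h′ | k , w′⊕x≡k , z≡k′ = begin
    y    ≡⟨ y≡h′ ⟩
    h ′  ≡⟨ cong _′ (just-injective (trans (sym w′⊕x≡h) w′⊕x≡k)) ⟩
    k ′  ≡⟨ sym z≡k′ ⟩
    z    ∎
    where open ≡-Reasoning

  x⊕y≡x⇒y≡𝟘 : ∀ x y → x ⊕ y ≡ just x → y ≡ 𝟘
  x⊕y≡x⇒y≡𝟘 x y x⊕y≡x = ⊕-cancelˡ x y 𝟘 x x⊕y≡x (⊕-identity x)

  x⊕y≡𝟘⇒x≡𝟘 : ∀ x y → x ⊕ y ≡ just 𝟘 → x ≡ 𝟘
  x⊕y≡𝟘⇒x≡𝟘 x y x⊕y≡𝟘
    with ⊕-assoc x y 𝟙 𝟘 𝟙 x⊕y≡𝟘 (⊕-identityˡ 𝟙)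
  ... | f , y⊕𝟙≡f , _ with zero-one y f y⊕𝟙≡f
  ... | refl = just-injective (trans (sym (⊕-identity x)) x⊕y≡𝟘)

  ≼′⇒⊥ : ∀ a b c → a ⊕ c ≡ just (b ′) → _⊥_ EA a b
  ≼′⇒⊥ a b c a⊕c≡b′
    with ⊕-assoc c a b (b ′) 𝟙 (trans (⊕-comm c a) a⊕c≡b′)
                (trans (⊕-comm (b ′) b) (′-supp b))
  ... | f , a⊕b≡f , _ = subst Is-just (sym a⊕b≡f) (just tt)

  TwoLeOrd⇒⊥-self : ∀ a → TwoLeOrd EA a → Σ (E EA) λ d → a ⊕ a ≡ just d
  TwoLeOrd⇒⊥-self a two with 𝟘 ⊕ a | ⊕-identityˡ a
  ... | just .a | refl with a ⊕ a | two
  ...   | just d  | _  = d , refl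
  ...   | nothing | ()

  mult-undefined⇒maximal-multiple : ∀ a n → mult EA n a ≡ nothing →
    Σ ℕ λ k → Σ (E EA) λ m → (mult EA k a ≡ just m) × (m ⊕ a ≡ nothing)
  mult-undefined⇒maximal-multiple a zero ()
  mult-undefined⇒maximal-multiple a (suc k) k+1·a≡nothing with mult EA k a in k·a≡
  ... | nothing = mult-undefined⇒maximal-multiple a k k·a≡
  ... | just m  = k , m , k·a≡ , k+1·a≡nothing

  OrdFinite⇒maximal-multiple : ∀ a → OrdFinite EA a →
    Σ ℕ λ k → Σ (E EA) λ m → (mult EA k a ≡ just m) × (m ⊕ a ≡ nothing)
  OrdFinite⇒maximal-multiple a (N , bound) with mult EA (suc N) a in N+1·a≡
  ... | just _  = contradiction (bound (suc N) (subst Is-just (sym N+1·a≡) (just tt))) 1+n≰n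
  ... | nothing = mult-undefined⇒maximal-multiple a (suc N) N+1·a≡

module SequentialProductProperties (EA : EffectAlgebra) {_∘_ : E EA → E EA → E EA}
                                   (sp : IsSequentialProduct EA _∘_) where
  open EffectAlgebra EA hiding (E)
  open EffectAlgebraProperties EA
  open IsSequentialProduct sp

  ∘-zeroʳ : ∀ a → a ∘ 𝟘 ≡ 𝟘
  ∘-zeroʳ a = x⊕y≡x⇒y≡𝟘 (a ∘ 𝟘) (a ∘ 𝟘) (S1 a 𝟘 𝟘 𝟘 (⊕-identity 𝟘))

  ∘-identityʳ : ∀ a → a ∘ 𝟙 ≡ a
  ∘-identityʳ a = begin
    a ∘ 𝟙      ≡⟨ cong (a ∘_) 𝟙≡𝟘′ ⟩
    a ∘ (𝟘 ′)  ≡⟨ proj₁ (S4 a 𝟘 (S3 a 𝟘 (∘-zeroʳ a))) ⟩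
    (𝟘 ′) ∘ a  ≡⟨ cong (_∘ a) (sym 𝟙≡𝟘′) ⟩
    𝟙 ∘ a      ≡⟨ S2 a ⟩
    a          ∎
    where open ≡-Reasoning

  ∘-split : ∀ a b → (a ∘ b) ⊕ (a ∘ (b ′)) ≡ just a
  ∘-split a b = trans (S1 a b (b ′) 𝟙 (′-supp b)) (cong just (∘-identityʳ a))

  ∘≡𝟘⇒∘-mult≡𝟘 : ∀ a b → a ∘ b ≡ 𝟘 → ∀ k m → mult EA k b ≡ just m → a ∘ m ≡ 𝟘
  ∘≡𝟘⇒∘-mult≡𝟘 a b a∘b≡𝟘 zero _ refl = ∘-zeroʳ a
  ∘≡𝟘⇒∘-mult≡𝟘 a b a∘b≡𝟘 (suc k) m k+1·b≡m with mult EA k b in k·b≡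
  ... | just n with S1 a n b m k+1·b≡m
  ...   | a∘n⊕a∘b≡a∘m rewrite ∘≡𝟘⇒∘-mult≡𝟘 a b a∘b≡𝟘 k n k·b≡ | a∘b≡𝟘 =
    sym (just-injective (trans (sym (⊕-identity 𝟘)) a∘n⊕a∘b≡a∘m))

  ∘≡𝟘⇒′∘≡ : ∀ a b → a ∘ b ≡ 𝟘 → (b ′) ∘ a ≡ a
  ∘≡𝟘⇒′∘≡ a b a∘b≡𝟘 = begin
    (b ′) ∘ a  ≡⟨ sym (proj₁ (S4 a b (S3 a b a∘b≡𝟘))) ⟩
    a ∘ (b ′)  ≡⟨ just-injective (trans (sym (⊕-identityˡ (a ∘ (b ′)))) 𝟘⊕a∘b′≡a) ⟩
    a          ∎
    where
    open ≡-Reasoning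
    𝟘⊕a∘b′≡a : 𝟘 ⊕ (a ∘ (b ′)) ≡ just a
    𝟘⊕a∘b′≡a = subst (λ x → x ⊕ (a ∘ (b ′)) ≡ just a) a∘b≡𝟘 (∘-split a b)

  ∘≡𝟘⇒⊥ : ∀ a b → a ∘ b ≡ 𝟘 → _⊥_ EA a b
  ∘≡𝟘⇒⊥ a b a∘b≡𝟘 = ≼′⇒⊥ a b ((b ′) ∘ (a ′))
    (subst (λ x → x ⊕ ((b ′) ∘ (a ′)) ≡ just (b ′)) (∘≡𝟘⇒′∘≡ a b a∘b≡𝟘) (∘-split (b ′) a))

  ∘-idempotent∧⊥-self⇒≡𝟘 : ∀ a d → a ∘ a ≡ a → a ⊕ a ≡ just d → a ≡ 𝟘
  ∘-idempotent∧⊥-self⇒≡𝟘 a d a∘a≡a a⊕a≡d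
    with ⊕-assoc a a (a ∘ (d ′)) d a a⊕a≡d d⊕a∘d′≡a
    where
    a⊕a≡a∘d : a ⊕ a ≡ just (a ∘ d)
    a⊕a≡a∘d = subst (λ x → x ⊕ x ≡ just (a ∘ d)) a∘a≡a (S1 a a a d a⊕a≡d)
    d⊕a∘d′≡a : d ⊕ (a ∘ (d ′)) ≡ just a
    d⊕a∘d′≡a = subst (λ x → x ⊕ (a ∘ (d ′)) ≡ just a)
                 (just-injective (trans (sym a⊕a≡a∘d) a⊕a≡d)) (∘-split a d)
  ... | f , a⊕a∘d′≡f , a⊕f≡a with x⊕y≡x⇒y≡𝟘 a f a⊕f≡a
  ... | refl = x⊕y≡𝟘⇒x≡𝟘 a (a ∘ (d ′)) a⊕a∘d′≡f

  ∘-self≡𝟘⇒¬OrdFinite : ∀ a → a ∘ a ≡ 𝟘 → ¬ OrdFinite EA a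
  ∘-self≡𝟘⇒¬OrdFinite a a∘a≡𝟘 fin
    with OrdFinite⇒maximal-multiple a fin
  ... | k , m , k·a≡m , m⊕a≡nothing
    with subst Is-just (trans (⊕-comm a m) m⊕a≡nothing)
           (∘≡𝟘⇒⊥ a m (∘≡𝟘⇒∘-mult≡𝟘 a a a∘a≡𝟘 k m k·a≡m))
  ... | ()

theorem4p1 : (EA : EffectAlgebra) (p : E EA) →
             IsAtom EA p → TwoLeOrd EA p → OrdFinite EA p →
             ¬ (Σ (E EA → E EA → E EA) λ _∘_ → IsSequentialProduct EA _∘_)
theorem4p1 EA p (p≢𝟘 , minimal) two fin (_∘_ , sp) =
  let d , p⊕p≡d = TwoLeOrd⇒⊥-self p two
  in  p≢𝟘 (∘-idempotent∧⊥-self⇒≡𝟘 p d p∘p≡p p⊕p≡d)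
  where
  open EffectAlgebra EA hiding (E)
  open EffectAlgebraProperties EA
  open SequentialProductProperties EA sp

  p∘p≡p : p ∘ p ≡ p
  p∘p≡p = minimal (p ∘ p) (p ∘ (p ′) , ∘-split p p)
            (λ p∘p≡𝟘 → ∘-self≡𝟘⇒¬OrdFinite p p∘p≡𝟘 fin)
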